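{- For any bi-Heyting algebra $A$ and any subset $F\subseteq A$, the following are equivalent: (1) $F$ is a wBIL-filter; (2) $F$ is a lattice filter, i.e. $\top\in F$, $F$ is upward closed ($a\in F$ and $a\le b$ imply $b\in F$), and $a,b\in F$ implies $a\wedge b\in F$.
   Context: Fix a countably infinite set $\mathrm{Prop}$ of propositional variables. Bi-intuitionistic formulas are generated by $\phi ::= p \mid \bot \mid \top \mid \phi\wedge\phi \mid \phi\vee\phi \mid \phi\to\phi \mid \phi\prec\phi$ with $p\in\mathrm{Prop}$ ($\prec$ is exclusion). Abbreviations: $\neg\phi := \phi\to\bot$, ${\sim}\phi := \top\prec\phi$. An axiom is any instance of: (A1) $\phi\to(\psi\to\phi)$; (A2) $(\phi\to(\psi\to\chi))\to((\phi\to\psi)\to(\phi\to\chi))$; (A3) $\phi\to(\phi\vee\psi)$; (A4) $\psi\to(\phi\vee\psi)$; (A5) $(\phi\to\chi)\to((\psi\to\chi)\to((\phi\vee\psi)\to\chi))$; (A6) $(\phi\wedge\psi)\to\phi$; (A7) $(\phi\wedge\psi)\to\psi$; (A8) $(\chi\to\phi)\to((\chi\to\psi)\to(\chi\to(\phi\wedge\psi)))$; (A9) $\bot\to\phi$; (A10) $\phi\to\top$; (A11) $\phi\to(\psi\vee(\phi\prec\psi))$; (A12) $(\phi\prec\psi)\to{\sim}(\phi\to\psi)$; (A13) $((\phi\prec\psi)\prec\chi)\to(\phi\prec(\psi\vee\chi))$; (A14) $\neg(\phi\prec\psi)\to(\phi\to\psi)$. wBIL is the relation $\Gamma\vdash_w\phi$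 holding iff $\Gamma\vdash\phi$ is derivable with: (Ax) $\Gamma\vdash\phi$ for any axiom $\phi$; (El) $\Gamma\vdash\phi$ if $\phi\in\Gamma$; (MP) from $\Gamma\vdash\phi$ and $\Gamma\vdash\phi\to\psi$ infer $\Gamma\vdash\psi$; (wDN) from $\emptyset\vdash\phi$ infer $\Gamma\vdash\neg{\sim}\phi$. A bi-Heyting algebra is an algebra $(A,\top,\bot,\wedge,\vee,\to,\prec)$ whose reduct $(A,\top,\bot,\wedge,\vee)$ is a bounded lattice (order $a\le b$ iff $a=a\wedge b$) with $a\wedge b\le c\iff a\le b\to c$ and $a\le b\vee c\iff a\prec b\le c$ for all $a,b,c$. A valuation $v:\mathrm{Prop}\to A$ extends to $\bar v$ on formulas. A wBIL-filter on $A$ is a set $F\subseteq A$ such that for all sets of formulas $\Gamma\cup\{\phi\}$ and valuations $v$ on $A$: if $\Gamma\vdash_w\phi$ and $\bar v(\gamma)\in F$ for all $\gamma\in\Gamma$, then $\bar v(\phi)\in F$. -}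

module Defs where

open import Level using (Level; 0ℓ; _⊔_) renaming (suc to lsuc)
open import Data.Nat using (ℕ)
open import Data.Product using (_×_)
open import Relation.Binary.PropositionalEquality using (_≡_)
open import Relation.Unary using (Pred; _∈_; ∅)
open import Function.Bundles using (_⇔_)

infixr 5 _⇒_
infixl 7 _∧'_
infixl 6 _∨'_
infix 8 _≺_

data Form : Set where
  var  : ℕ → Form
  ⊥'   : Form
  ⊤'   : Form
  _∧'_ : Form → Form → Form
  _∨'_ : Form → Form → Form
  _⇒_  : Form → Form → Form
  _≺_  : Form → Form → Form

¬' : Form → Form
¬' φ = φ ⇒ ⊥'

∼' : Form → Form
∼' φ = ⊤' ≺ φ

data Axiom : Form → Set where
  A1  : ∀ φ ψ → Axiom (φ ⇒ (ψ ⇒ φ))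
  A2  : ∀ φ ψ χ → Axiom ((φ ⇒ (ψ ⇒ χ)) ⇒ ((φ ⇒ ψ) ⇒ (φ ⇒ χ)))
  A3  : ∀ φ ψ → Axiom (φ ⇒ (φ ∨' ψ))
  A4  : ∀ φ ψ → Axiom (ψ ⇒ (φ ∨' ψ))
  A5  : ∀ φ ψ χ → Axiom ((φ ⇒ χ) ⇒ ((ψ ⇒ χ) ⇒ ((φ ∨' ψ) ⇒ χ)))
  A6  : ∀ φ ψ → Axiom ((φ ∧' ψ) ⇒ φ)
  A7  : ∀ φ ψ → Axiom ((φ ∧' ψ) ⇒ ψ)
  A8  : ∀ φ ψ χ → Axiom ((χ ⇒ φ) ⇒ ((χ ⇒ ψ) ⇒ (χ ⇒ (φ ∧' ψ))))
  A9  : ∀ φ → Axiom (⊥' ⇒ φ)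
  A10 : ∀ φ → Axiom (φ ⇒ ⊤')
  A11 : ∀ φ ψ → Axiom (φ ⇒ (ψ ∨' (φ ≺ ψ)))
  A12 : ∀ φ ψ → Axiom ((φ ≺ ψ) ⇒ ∼' (φ ⇒ ψ))
  A13 : ∀ φ ψ χ → Axiom (((φ ≺ ψ) ≺ χ) ⇒ (φ ≺ (ψ ∨' χ)))
  A14 : ∀ φ ψ → Axiom (¬' (φ ≺ ψ) ⇒ (φ ⇒ ψ))

infix 4 _⊢w_
data _⊢w_ : Pred Form 0ℓ → Form → Set₁ where
  ax  : ∀ {Γ φ} → Axiom φ → Γ ⊢w φ
  el  : ∀ {Γ φ} → φ ∈ Γ → Γ ⊢w φ
  mp  : ∀ {Γ φ ψ} → Γ ⊢w φ → Γ ⊢w (φ ⇒ ψ) → Γ ⊢w ψ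
  wDN : ∀ {Γ φ} → ∅ ⊢w φ → Γ ⊢w ¬' (∼' φ)

record BiHeytingAlgebra (c : Level) : Set (lsuc c) where
  infixl 7 _∧_
  infixl 6 _∨_
  infixr 5 _⇨_
  infix 8 _∖_
  infix 4 _≤_
  field
    Carrier : Set c
    ⊤ ⊥     : Carrier
    _∧_ _∨_ _⇨_ _∖_ : Carrier → Carrier → Carrier

  _≤_ : Carrier → Carrier → Set c
  a ≤ b = a ≡ a ∧ b

  field
    ∧-assoc : ∀ a b c → (a ∧ b) ∧ c ≡ a ∧ (b ∧ c)
    ∨-assoc : ∀ a b c → (a ∨ b) ∨ c ≡ a ∨ (b ∨ c)
    ∧-comm  : ∀ a b → a ∧ b ≡ b ∧ a
    ∨-comm  : ∀ a b → a ∨ b ≡ b ∨ a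
    ∧-absorbs-∨ : ∀ a b → a ∧ (a ∨ b) ≡ a
    ∨-absorbs-∧ : ∀ a b → a ∨ (a ∧ b) ≡ a
    ∧-identity : ∀ a → a ∧ ⊤ ≡ a
    ∨-identity : ∀ a → a ∨ ⊥ ≡ a
    ⇨-residual : ∀ a b c → (a ∧ b ≤ c) ⇔ (a ≤ b ⇨ c)
    ∖-residual : ∀ a b c → (a ≤ b ∨ c) ⇔ (a ∖ b ≤ c)

module _ {c : Level} (A : BiHeytingAlgebra c) where
  open BiHeytingAlgebra A

  ⟦_⟧ : Form → (ℕ → Carrier) → Carrier
  ⟦ var p ⟧ v = v p
  ⟦ ⊥' ⟧ v = ⊥
  ⟦ ⊤' ⟧ v = ⊤
  ⟦ φ ∧' ψ ⟧ v = ⟦ φ ⟧ v ∧ ⟦ ψ ⟧ v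
  ⟦ φ ∨' ψ ⟧ v = ⟦ φ ⟧ v ∨ ⟦ ψ ⟧ v
  ⟦ φ ⇒ ψ ⟧ v = ⟦ φ ⟧ v ⇨ ⟦ ψ ⟧ v
  ⟦ φ ≺ ψ ⟧ v = ⟦ φ ⟧ v ∖ ⟦ ψ ⟧ v

  IsWBILFilter : ∀ {ℓ} → Pred Carrier ℓ → Set (lsuc 0ℓ ⊔ c ⊔ ℓ)
  IsWBILFilter F = ∀ (Γ : Pred Form 0ℓ) (φ : Form) (v : ℕ → Carrier) →
    Γ ⊢w φ → (∀ γ → γ ∈ Γ → ⟦ γ ⟧ v ∈ F) → ⟦ φ ⟧ v ∈ F

  IsLatticeFilter : ∀ {ℓ} → Pred Carrier ℓ → Set (c ⊔ ℓ)
  IsLatticeFilter F =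
    (⊤ ∈ F) ×
    (∀ a b → a ∈ F → a ≤ b → b ∈ F) ×
    (∀ a b → a ∈ F → b ∈ F → (a ∧ b) ∈ F)

-- The order of a bi-Heyting algebra is that of a Heyting algebra, so every axiom
-- takes the value ⊤ and a ∧ (a ⇨ b) ≤ b validates (MP): a lattice filter is closed
-- under wBIL-consequence by induction on derivations.  The premise of (wDN) is a
-- theorem, so by the same induction for the principal filter ↑⊤ it is valued ⊤;
-- then ∼ a = ⊤ ∖ a = ⊥ and ¬ ∼ a = ⊤.  Conversely, the derivations {p ∧ q} ⊢ q,
-- {p, q} ⊢ p ∧ q and ∅ ⊢ ⊤ make a wBIL-filter upward closed, closed under meets
-- and contain ⊤.
module Submission where

open import Defs
open import Level using (Level; 0ℓ)
open import Data.Nat using (ℕ; zero; suc)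
open import Data.Product using (_,_)
open import Data.Sum using (inj₁; inj₂)
open import Function.Bundles using (_⇔_; mk⇔; Equivalence)
open import Relation.Unary using (Pred; _∈_; ∅; ｛_｝; _∪_)
open import Relation.Binary.PropositionalEquality
  using (_≡_; refl; sym; cong; cong₂; subst; isEquivalence; module ≡-Reasoning)
import Algebra.Lattice.Bundles as Alg
open import Algebra.Lattice.Properties.Lattice using (∨-∧-isOrderTheoreticLattice)
open import Relation.Binary.Lattice using (HeytingAlgebra)
import Relation.Binary.Lattice.Properties.HeytingAlgebra as HeytingAlgebraProperties

module BiHeytingAlgebraProperties {c : Level} (A : BiHeytingAlgebra c) where

  open BiHeytingAlgebra A

  lattice : Alg.Lattice c c
  lattice = record
    { Carrier   = Carrier
    ; _≈_       = _≡_
    ; _∨_       = _∨_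
    ; _∧_       = _∧_
    ; isLattice = record
      { isEquivalence = isEquivalence
      ; ∨-comm        = ∨-comm
      ; ∨-assoc       = ∨-assoc
      ; ∨-cong        = cong₂ _∨_
      ; ∧-comm        = ∧-comm
      ; ∧-assoc       = ∧-assoc
      ; ∧-cong        = cong₂ _∧_
      ; absorptive    = ∨-absorbs-∧ , ∧-absorbs-∨
      }
    }

  ⊥≤x : ∀ x → ⊥ ≤ x
  ⊥≤x x = sym (begin
    ⊥ ∧ x        ≡⟨ cong (⊥ ∧_) (sym (∨-identity x)) ⟩
    ⊥ ∧ (x ∨ ⊥)  ≡⟨ cong (⊥ ∧_) (∨-comm x ⊥) ⟩
    ⊥ ∧ (⊥ ∨ x)  ≡⟨ ∧-absorbs-∨ ⊥ x ⟩
    ⊥            ∎)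
    where open ≡-Reasoning

  heytingAlgebra : HeytingAlgebra c c c
  heytingAlgebra = record
    { isHeytingAlgebra = record
      { isBoundedLattice = record
        { isLattice = ∨-∧-isOrderTheoreticLattice lattice
        ; maximum   = λ x → sym (∧-identity x)
        ; minimum   = ⊥≤x
        }
      ; exponential = λ w x y → Equivalence.to (⇨-residual w x y) , Equivalence.from (⇨-residual w x y)
      }
    }

  open HeytingAlgebra heytingAlgebra public
    using (x∧y≤x; x∧y≤y; ∧-greatest; x≤x∨y; y≤x∨y; ∨-least; maximum; transpose-⇨)
    renaming (refl to ≤-refl; trans to ≤-trans)
  open HeytingAlgebraProperties heytingAlgebra public
    using (⇨-eval; y≤x⇨y; ∧-distribˡ-∨-≤; ⇨-distribˡ-∧-≥; ⇨-distribˡ-∨-∧-≥)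

  transpose-∖ : ∀ {x y z} → x ≤ y ∨ z → x ∖ y ≤ z
  transpose-∖ {x} {y} {z} = Equivalence.to (∖-residual x y z)

  transpose-∨ : ∀ {x y z} → x ∖ y ≤ z → x ≤ y ∨ z
  transpose-∨ {x} {y} {z} = Equivalence.from (∖-residual x y z)

  x≤y∨x∖y : ∀ {x y} → x ≤ y ∨ x ∖ y
  x≤y∨x∖y = transpose-∨ ≤-refl

  ≤-mp : ∀ {w x y} → w ≤ x → w ≤ x ⇨ y → w ≤ y
  ≤-mp w≤x w≤x⇨y = ≤-trans (∧-greatest w≤x⇨y w≤x) ⇨-eval

  ⇨-distrib-⇨ : ∀ x y z → x ⇨ (y ⇨ z) ≤ (x ⇨ y) ⇨ (x ⇨ z)
  ⇨-distrib-⇨ x y z = transpose-⇨ (transpose-⇨ (≤-mp (≤-mp w≤x w≤x⇨y) (≤-mp w≤x w≤x⇨y⇨z)))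
    where
    w≤x : ((x ⇨ (y ⇨ z)) ∧ (x ⇨ y)) ∧ x ≤ x
    w≤x = x∧y≤y _ _
    w≤x⇨y : ((x ⇨ (y ⇨ z)) ∧ (x ⇨ y)) ∧ x ≤ x ⇨ y
    w≤x⇨y = ≤-trans (x∧y≤x _ _) (x∧y≤y _ _)
    w≤x⇨y⇨z : ((x ⇨ (y ⇨ z)) ∧ (x ⇨ y)) ∧ x ≤ x ⇨ (y ⇨ z)
    w≤x⇨y⇨z = ≤-trans (x∧y≤x _ _) (x∧y≤x _ _)

  ⊤≤⇨ : ∀ {x y} → x ≤ y → ⊤ ≤ x ⇨ y
  ⊤≤⇨ x≤y = transpose-⇨ (≤-trans (x∧y≤y _ _) x≤y)

  ≤-by-cases : ∀ {x y z w} → x ≤ y ∨ z → x ∧ y ≤ w → x ∧ z ≤ w → x ≤ w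
  ≤-by-cases {x} {y} {z} x≤y∨z x∧y≤w x∧z≤w =
    ≤-trans (∧-greatest ≤-refl x≤y∨z) (≤-trans (∧-distribˡ-∨-≤ x y z) (∨-least x∧y≤w x∧z≤w))

  ∖≤∼⇨ : ∀ x y → x ∖ y ≤ ⊤ ∖ (x ⇨ y)
  ∖≤∼⇨ x y = transpose-∖ (≤-by-cases (≤-trans (maximum x) x≤y∨x∖y)
    (≤-trans (≤-mp (x∧y≤x _ _) (x∧y≤y _ _)) (x≤x∨y _ _))
    (≤-trans (x∧y≤y _ _) (y≤x∨y _ _)))

  ∖∖≤∖∨ : ∀ x y z → (x ∖ y) ∖ z ≤ x ∖ (y ∨ z)
  ∖∖≤∖∨ x y z = transpose-∖ (transpose-∖ (subst (x ≤_) (∨-assoc y z (x ∖ (y ∨ z))) x≤y∨x∖y))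

  ¬∖≤⇨ : ∀ x y → (x ∖ y ⇨ ⊥) ≤ x ⇨ y
  ¬∖≤⇨ x y = transpose-⇨ (≤-by-cases (≤-trans (x∧y≤y _ _) x≤y∨x∖y)
    (x∧y≤y _ _)
    (≤-trans (≤-mp (x∧y≤y _ _) (≤-trans (x∧y≤x _ _) (x∧y≤x _ _))) (⊥≤x y)))

  ⊤≤⇒⊤≤¬∼ : ∀ {x} → ⊤ ≤ x → ⊤ ≤ (⊤ ∖ x ⇨ ⊥)
  ⊤≤⇒⊤≤¬∼ {x} ⊤≤x =
    ⊤≤⇨ (transpose-∖ (subst (⊤ ≤_) (sym (∨-identity x)) ⊤≤x))

module _ {c : Level} (A : BiHeytingAlgebra c) where

  open BiHeytingAlgebra A
  open BiHeytingAlgebraProperties A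

  axiom-valid : ∀ {φ} (v : ℕ → Carrier) → Axiom φ → ⊤ ≤ ⟦ A ⟧ φ v
  axiom-valid v (A1 φ ψ)    = ⊤≤⇨ y≤x⇨y
  axiom-valid v (A2 φ ψ χ)  = ⊤≤⇨ (⇨-distrib-⇨ _ _ _)
  axiom-valid v (A3 φ ψ)    = ⊤≤⇨ (x≤x∨y _ _)
  axiom-valid v (A4 φ ψ)    = ⊤≤⇨ (y≤x∨y _ _)
  axiom-valid v (A5 φ ψ χ)  = ⊤≤⇨ (transpose-⇨ (⇨-distribˡ-∨-∧-≥ _ _ _))
  axiom-valid v (A6 φ ψ)    = ⊤≤⇨ (x∧y≤x _ _)
  axiom-valid v (A7 φ ψ)    = ⊤≤⇨ (x∧y≤y _ _)
  axiom-valid v (A8 φ ψ χ)  = ⊤≤⇨ (transpose-⇨ (⇨-distribˡ-∧-≥ _ _ _))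
  axiom-valid v (A9 φ)      = ⊤≤⇨ (⊥≤x _)
  axiom-valid v (A10 φ)     = ⊤≤⇨ (maximum _)
  axiom-valid v (A11 φ ψ)   = ⊤≤⇨ x≤y∨x∖y
  axiom-valid v (A12 φ ψ)   = ⊤≤⇨ (∖≤∼⇨ _ _)
  axiom-valid v (A13 φ ψ χ) = ⊤≤⇨ (∖∖≤∖∨ _ _ _)
  axiom-valid v (A14 φ ψ)   = ⊤≤⇨ (¬∖≤⇨ _ _)

  ↑-isLatticeFilter : ∀ x → IsLatticeFilter A (x ≤_)
  ↑-isLatticeFilter x = maximum x , (λ _ _ → ≤-trans) , (λ _ _ → ∧-greatest)

  lattice-filter⇒wBIL-filter : ∀ {ℓ} {F : Pred Carrier ℓ} → IsLatticeFilter A F → IsWBILFilter A F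
  lattice-filter⇒wBIL-filter (⊤∈F , F-upward , _) Γ φ v (ax a) Γ⊆F =
    F-upward _ _ ⊤∈F (axiom-valid v a)
  lattice-filter⇒wBIL-filter _ Γ φ v (el φ∈Γ) Γ⊆F = Γ⊆F φ φ∈Γ
  lattice-filter⇒wBIL-filter {F = F} F-filter@(_ , F-upward , F-∧) Γ φ v (mp ⊢ψ ⊢ψ⇒φ) Γ⊆F =
    F-upward _ _ (F-∧ _ _ (sound ⊢ψ⇒φ) (sound ⊢ψ)) ⇨-eval
    where
    sound : ∀ {χ} → Γ ⊢w χ → ⟦ A ⟧ χ v ∈ F
    sound ⊢χ = lattice-filter⇒wBIL-filter F-filter Γ _ v ⊢χ Γ⊆F
  lattice-filter⇒wBIL-filter (⊤∈F , F-upward , _) Γ _ v (wDN {φ = ψ} ⊢ψ) Γ⊆F =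
    F-upward _ _ ⊤∈F (⊤≤⇒⊤≤¬∼ ⊤≤⟦ψ⟧)
    where
    ⊤≤⟦ψ⟧ : ⊤ ≤ ⟦ A ⟧ ψ v
    ⊤≤⟦ψ⟧ = lattice-filter⇒wBIL-filter (↑-isLatticeFilter ⊤) ∅ ψ v ⊢ψ (λ _ ())

module _ {Γ : Pred Form 0ℓ} where

  ⊢-id : ∀ φ → Γ ⊢w φ ⇒ φ
  ⊢-id φ = mp (ax (A1 φ φ)) (mp (ax (A1 φ (φ ⇒ φ))) (ax (A2 φ (φ ⇒ φ) φ)))

  ⊢-const : ∀ {φ} ψ → Γ ⊢w φ → Γ ⊢w ψ ⇒ φ
  ⊢-const ψ ⊢φ = mp ⊢φ (ax (A1 _ ψ))

  ⊢-⊤ : Γ ⊢w ⊤'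
  ⊢-⊤ = mp (ax (A9 ⊥')) (ax (A10 (⊥' ⇒ ⊥')))

  ⊢-∧-intro : ∀ {φ ψ} → Γ ⊢w φ → Γ ⊢w ψ → Γ ⊢w φ ∧' ψ
  ⊢-∧-intro {φ} {ψ} ⊢φ ⊢ψ = mp ⊢φ (mp (⊢-const φ ⊢ψ) (mp (⊢-id φ) (ax (A8 φ ψ φ))))

  ⊢-∧-elimʳ : ∀ {φ ψ} → Γ ⊢w φ ∧' ψ → Γ ⊢w ψ
  ⊢-∧-elimʳ ⊢φ∧ψ = mp ⊢φ∧ψ (ax (A7 _ _))

valuation₂ : ∀ {a} {X : Set a} → X → X → ℕ → X
valuation₂ x y zero    = x
valuation₂ x y (suc _) = y

module _ {c ℓ : Level} (A : BiHeytingAlgebra c) {F : Pred (BiHeytingAlgebra.Carrier A) ℓ} where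

  open BiHeytingAlgebra A

  wBIL-filter⇒lattice-filter : IsWBILFilter A F → IsLatticeFilter A F
  wBIL-filter⇒lattice-filter W = ⊤∈F , F-upward , F-∧
    where
    ⊤∈F : ⊤ ∈ F
    ⊤∈F = W ∅ ⊤' (λ _ → ⊤) ⊢-⊤ (λ _ ())

    F-upward : ∀ a b → a ∈ F → a ≤ b → b ∈ F
    F-upward a b a∈F a≤b = W ｛ var 0 ∧' var 1 ｝ (var 1) (valuation₂ a b)
      (⊢-∧-elimʳ (el refl)) (λ { _ refl → subst (_∈ F) a≤b a∈F })

    F-∧ : ∀ a b → a ∈ F → b ∈ F → a ∧ b ∈ F
    F-∧ a b a∈F b∈F = W (｛ var 0 ｝ ∪ ｛ var 1 ｝) (var 0 ∧' var 1) (valuation₂ a b)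
      (⊢-∧-intro (el (inj₁ refl)) (el (inj₂ refl)))
      (λ { _ (inj₁ refl) → a∈F ; _ (inj₂ refl) → b∈F })

mainTheorem18 : ∀ {c ℓ : Level} (A : BiHeytingAlgebra c) (F : Pred (BiHeytingAlgebra.Carrier A) ℓ) →
    IsWBILFilter A F ⇔ IsLatticeFilter A F
mainTheorem18 A F = mk⇔ (wBIL-filter⇒lattice-filter A) (lattice-filter⇒wBIL-filter A)
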